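{- Let $p_0\ge 3$ be a prime and let $p_0<p_1<p_2<\cdots$ be the consecutive primes starting from $p_0$. Let $g$ be a gap (a positive even integer) that occurs in the cycle of gaps $\mathcal{G}(p_0^\#)$. Then for all primes $p_k>p_1$, the quadratic density satisfies $\eta_g(p_k)>\eta_g(p_{k-1})$; that is, $\eta_g$ increases at every such stage.
   Context: For a prime $p$, $p^\#$ is the product of all primes $\le p$. The cycle of gaps $\mathcal{G}(p^\#)$ is the cyclic sequence of $\phi(p^\#)$ differences between consecutive integers coprime to $p^\#$ over one period, starting from $1$ (total span $p^\#$). For a gap $g$, $n_{g,1}(p^\#)$ is the number of occurrences of $g$ as a single gap in $\mathcal{G}(p^\#)$. The quadratic density of $g$ at the prime $p_k$ (with next prime $p_{k+1}$) is $$\eta_g(p_k)=\frac{1}{p_{k+1}-p_k}\cdot n_{g,1}(p_k^\#)\cdot\frac{p_{k+1}^2-p_k^2}{p_k^\#}= n_{g,1}(p_k^\#)\cdot\frac{p_{k+1}+p_k}{p_k^\#},$$ interpreted as the expected average number of occurrences of $g$ in each interval $[n^2,(n+1)^2]$, $p_k\le n<p_{k+1}$, under uniform sampling from $\mathcal{G}(p_k^\#)$. -}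

module Defs where

open import Data.Nat using (ℕ; zero; suc; _+_; _*_; _∸_; _<_; NonZero)
open import Data.Nat.Properties using (_≟_)
open import Data.Nat.Primality using (Prime; prime?)
open import Data.Nat.Coprimality using (coprime?)
open import Data.List using (List; []; _∷_; map; upTo; filter; length)
open import Data.Integer using (+_)
open import Data.Rational.Unnormalised using (ℚᵘ; _/_)
open import Relation.Nullary using (¬_; yes; no)

primorial : ℕ → ℕ
primorial zero = 1
primorial (suc n) with prime? (suc n)
... | yes _ = suc n * primorial n
... | no  _ = primorial n

primorial-nonZero : ∀ n → NonZero (primorial n)
primorial-nonZero zero = _
primorial-nonZero (suc n) with prime? (suc n)
... | yes _ = m*n≢0 (suc n) (primorial n) {{_}} {{primorial-nonZero n}}
  where open import Data.Nat.Properties using (m*n≢0)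
... | no  _ = primorial-nonZero n

-- integers in [1, P+1] coprime to P, in increasing order
-- (starts at 1, ends at P+1 ≡ 1 mod P, so the gaps span exactly one period)
coprimeReps : ℕ → List ℕ
coprimeReps P = filter (λ r → coprime? r P) (map suc (upTo (suc P)))

diffs : List ℕ → List ℕ
diffs (x ∷ y ∷ xs) = (y ∸ x) ∷ diffs (y ∷ xs)
diffs _ = []

cycleOfGaps : ℕ → List ℕ
cycleOfGaps P = diffs (coprimeReps P)

nGap : ℕ → ℕ → ℕ
nGap g P = length (filter (_≟ g) (cycleOfGaps P))

NextPrime : ℕ → ℕ → Set
NextPrime p q = Prime p × Prime q × p < q × (∀ c → p < c → c < q → ¬ Prime c)
  where open import Data.Product using (_×_)

-- quadratic density η_g(p) = n_{g,1}(p#) · (p' + p) / p#, where p' is the next prime after p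
η : (g p p' : ℕ) → ℚᵘ
η g p p' = (+ (nGap g (primorial p) * (p' + p))) / primorial p
  where instance _ = primorial-nonZero p

module Submission where

-- A gap g of 𝒢(P) starting at x has p lifts x + jP (j < p) in the period of 𝒢(pP); such a lift is
-- still a gap of 𝒢(pP) unless p divides one of its two ends, and each end is hit by at most one j.
-- Hence n_g(p_k#) ≥ (p_k − 2) n_g(p_{k−1}#), which also keeps n_g positive from p₀ on, and
-- η_g(p_k) / η_g(p_{k−1}) ≥ (p_k − 2)(p_{k+1} + p_k) / (p_k (p_k + p_{k−1})), which exceeds 1
-- because three consecutive primes above 3 satisfy p_{k+1} ≥ p_{k−1} + 6.

open import Defs
open import Data.Empty using (⊥; ⊥-elim)
open import Data.Integer as ℤ using (+<+)
open import Data.Integer.Properties using (pos-*)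
open import Data.List using (List; []; _∷_; map; upTo; applyUpTo; filter; length)
open import Data.List.Membership.Propositional using (_∈_)
open import Data.List.Membership.Propositional.Properties using (∈-filter⁺)
open import Data.List.Properties using (map-upTo; filter-accept; filter-reject)
open import Data.Nat using (ℕ; zero; suc; _+_; _*_; _∸_; _≤_; _<_; z≤n; s≤s; NonZero; NonTrivial; >-nonZero; >-nonZero⁻¹)
open import Data.Nat.Coprimality using (Coprime; coprime?; coprime-divisor)
open import Data.Nat.Divisibility
open import Data.Nat.Primality
  using (Prime; prime?; prime⇒irreducible; euclidsLemma; ¬prime[1]; composite; composite⇒¬prime; composite[4])
open import Data.Nat.Properties
open import Algebra.Properties.CommutativeSemigroup +-commutativeSemigroup
  using () renaming (interchange to +-interchange)
open import Data.Nat.Tactic.RingSolver using (solve-∀)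
open import Data.Product using (_×_; _,_; proj₁)
open import Data.Rational.Unnormalised as ℚᵘ using (_>_; *<*)
open import Data.Sum as Sum using (_⊎_; inj₁; inj₂)
open import Function using (_∘_)
open import Relation.Binary.Definitions using (tri<; tri≈; tri>)
open import Relation.Binary.PropositionalEquality
open import Relation.Nullary using (Dec; yes; no; ¬_; ¬?)
open import Relation.Nullary.Decidable using (_×-dec_; _→-dec_)
open import Relation.Unary using (Decidable)

𝟙 : ∀ {A : Set} → Dec A → ℕ
𝟙 (yes _) = 1
𝟙 (no _)  = 0

𝟙-yes : ∀ {A : Set} (a? : Dec A) → A → 𝟙 a? ≡ 1
𝟙-yes (yes _) _ = refl
𝟙-yes (no ¬a) a = ⊥-elim (¬a a)

𝟙-no : ∀ {A : Set} (a? : Dec A) → ¬ A → 𝟙 a? ≡ 0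
𝟙-no (yes a) ¬a = ⊥-elim (¬a a)
𝟙-no (no _)  _  = refl

𝟙-cong : ∀ {A B : Set} (a? : Dec A) (b? : Dec B) → (A → B) → (B → A) → 𝟙 a? ≡ 𝟙 b?
𝟙-cong (yes a) b? to _    = sym (𝟙-yes b? (to a))
𝟙-cong (no ¬a) b? _  from = sym (𝟙-no b? (¬a ∘ from))

𝟙-cover : ∀ {A B : Set} (a? : Dec A) (b? : Dec B) → 1 ≤ 𝟙 (¬? a? ×-dec ¬? b?) + (𝟙 a? + 𝟙 b?)
𝟙-cover (yes _) _       = s≤s z≤n
𝟙-cover (no _)  (yes _) = s≤s z≤n
𝟙-cover (no _)  (no _)  = s≤s z≤n

sumFrom : ℕ → ℕ → (ℕ → ℕ) → ℕ
sumFrom a zero    f = 0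
sumFrom a (suc n) f = f a + sumFrom (suc a) n f

module _ where
  open ≡-Reasoning

  sumFrom-cong : ∀ a n {f h : ℕ → ℕ} → (∀ x → f x ≡ h x) → sumFrom a n f ≡ sumFrom a n h
  sumFrom-cong a zero    f≗h = refl
  sumFrom-cong a (suc n) f≗h = cong₂ _+_ (f≗h a) (sumFrom-cong (suc a) n f≗h)

  sumFrom-mono-≤ : ∀ a n {f h : ℕ → ℕ} → (∀ x → a ≤ x → x < a + n → f x ≤ h x) →
                   sumFrom a n f ≤ sumFrom a n h
  sumFrom-mono-≤ a zero    f≤h = z≤n
  sumFrom-mono-≤ a (suc n) f≤h = +-mono-≤ (f≤h a ≤-refl (m<m+n a (s≤s z≤n)))
    (sumFrom-mono-≤ (suc a) n λ x a<x x<1+a+n →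
      f≤h x (<⇒≤ a<x) (subst (x <_) (sym (+-suc a n)) x<1+a+n))

  sumFrom-const : ∀ a n c → sumFrom a n (λ _ → c) ≡ c * n
  sumFrom-const a zero    c = sym (*-zeroʳ c)
  sumFrom-const a (suc n) c = trans (cong (c +_) (sumFrom-const (suc a) n c)) (sym (*-suc c n))

  sumFrom-shift : ∀ a n c (f : ℕ → ℕ) → sumFrom a n (λ x → f (c + x)) ≡ sumFrom (c + a) n f
  sumFrom-shift a zero    c f = refl
  sumFrom-shift a (suc n) c f = cong (f (c + a) +_) (begin
    sumFrom (suc a) n (λ x → f (c + x)) ≡⟨ sumFrom-shift (suc a) n c f ⟩
    sumFrom (c + suc a) n f             ≡⟨ cong (λ b → sumFrom b n f) (+-suc c a) ⟩
    sumFrom (suc (c + a)) n f           ∎)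

  sumFrom-+ : ∀ a m n (f : ℕ → ℕ) → sumFrom a (m + n) f ≡ sumFrom a m f + sumFrom (m + a) n f
  sumFrom-+ a zero    n f = refl
  sumFrom-+ a (suc m) n f = begin
    f a + sumFrom (suc a) (m + n) f                        ≡⟨ cong (f a +_) (sumFrom-+ (suc a) m n f) ⟩
    f a + (sumFrom (suc a) m f + sumFrom (m + suc a) n f)  ≡⟨ sym (+-assoc (f a) _ _) ⟩
    f a + sumFrom (suc a) m f + sumFrom (m + suc a) n f
      ≡⟨ cong (λ b → f a + sumFrom (suc a) m f + sumFrom b n f) (+-suc m a) ⟩
    f a + sumFrom (suc a) m f + sumFrom (suc m + a) n f    ∎

  sumFrom-distrib-+ : ∀ a n (f h : ℕ → ℕ) → sumFrom a n (λ x → f x + h x) ≡ sumFrom a n f + sumFrom a n h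
  sumFrom-distrib-+ a zero    f h = refl
  sumFrom-distrib-+ a (suc n) f h = begin
    f a + h a + sumFrom (suc a) n (λ x → f x + h x)
      ≡⟨ cong (f a + h a +_) (sumFrom-distrib-+ (suc a) n f h) ⟩
    f a + h a + (sumFrom (suc a) n f + sumFrom (suc a) n h)
      ≡⟨ +-interchange (f a) (h a) _ _ ⟩
    f a + sumFrom (suc a) n f + (h a + sumFrom (suc a) n h)
      ∎

  sumFrom-comm : ∀ a m b n (h : ℕ → ℕ → ℕ) →
                 sumFrom a m (λ x → sumFrom b n (h x)) ≡ sumFrom b n (λ y → sumFrom a m (λ x → h x y))
  sumFrom-comm a zero    b n h = sym (sumFrom-const b n 0)
  sumFrom-comm a (suc m) b n h = begin
    sumFrom b n (h a) + sumFrom (suc a) m (λ x → sumFrom b n (h x))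
      ≡⟨ cong (sumFrom b n (h a) +_) (sumFrom-comm (suc a) m b n h) ⟩
    sumFrom b n (h a) + sumFrom b n (λ y → sumFrom (suc a) m (λ x → h x y))
      ≡⟨ sumFrom-distrib-+ b n (h a) _ ⟨
    sumFrom b n (λ y → h a y + sumFrom (suc a) m (λ x → h x y))
      ∎

  *-distribˡ-sumFrom : ∀ c a n (f : ℕ → ℕ) → c * sumFrom a n f ≡ sumFrom a n (λ x → c * f x)
  *-distribˡ-sumFrom c a zero    f = *-zeroʳ c
  *-distribˡ-sumFrom c a (suc n) f =
    trans (*-distribˡ-+ c (f a) _) (cong (c * f a +_) (*-distribˡ-sumFrom c (suc a) n f))

  sumFrom-blocks : ∀ a m n (f : ℕ → ℕ) →
                   sumFrom a (m * n) f ≡ sumFrom 0 m (λ j → sumFrom a n (λ x → f (j * n + x)))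
  sumFrom-blocks a zero    n f = refl
  sumFrom-blocks a (suc m) n f = begin
    sumFrom a (n + m * n) f
      ≡⟨ sumFrom-+ a n (m * n) f ⟩
    sumFrom a n f + sumFrom (n + a) (m * n) f
      ≡⟨ cong (sumFrom a n f +_) (sumFrom-blocks (n + a) m n f) ⟩
    sumFrom a n f + sumFrom 0 m (λ j → sumFrom (n + a) n (λ x → f (j * n + x)))
      ≡⟨ cong (sumFrom a n f +_) (sumFrom-cong 0 m λ j → sym (sumFrom-shift a n n (λ x → f (j * n + x)))) ⟩
    sumFrom a n f + sumFrom 0 m (λ j → sumFrom a n (λ x → f (j * n + (n + x))))
      ≡⟨ cong (sumFrom a n f +_) (sumFrom-cong 0 m λ j → sumFrom-cong a n λ x → cong f (reassoc j x)) ⟩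
    sumFrom a n f + sumFrom 0 m (λ j → sumFrom a n (λ x → f (suc j * n + x)))
      ≡⟨ cong (sumFrom a n f +_) (sumFrom-shift 0 m 1 _) ⟩
    sumFrom a n f + sumFrom 1 m (λ j → sumFrom a n (λ x → f (j * n + x)))
      ∎
    where
    reassoc : ∀ j x → j * n + (n + x) ≡ suc j * n + x
    reassoc j x = trans (sym (+-assoc (j * n) n x)) (cong (_+ x) (+-comm (j * n) n))

  sumFrom-𝟙-≤1 : ∀ {A : ℕ → Set} (A? : ∀ x → Dec (A x)) a n →
                 (∀ x y → x < a + n → y < a + n → A x → A y → x ≡ y) →
                 sumFrom a n (λ x → 𝟙 (A? x)) ≤ 1
  sumFrom-𝟙-≤1 A? a zero    _      = z≤n
  sumFrom-𝟙-≤1 A? a (suc n) unique with A? a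
  ... | yes Aa = s≤s (≤-trans rest≤0 (≤-reflexive (sumFrom-const (suc a) n 0)))
    where
    rest≤0 : sumFrom (suc a) n (λ x → 𝟙 (A? x)) ≤ sumFrom (suc a) n (λ _ → 0)
    rest≤0 = sumFrom-mono-≤ (suc a) n λ x a<x x<end → ≤-reflexive (𝟙-no (A? x) λ Ax →
      <-irrefl (unique a x (m<m+n a (s≤s z≤n)) (subst (x <_) (sym (+-suc a n)) x<end) Aa Ax) a<x)
  ... | no _ = sumFrom-𝟙-≤1 A? (suc a) n λ x y x< y< →
      unique x y (subst (x <_) (sym (+-suc a n)) x<) (subst (y <_) (sym (+-suc a n)) y<)

interval : ℕ → ℕ → List ℕ
interval a zero    = []
interval a (suc n) = a ∷ interval (suc a) n

applyUpTo≗interval : ∀ {f} a n → (∀ i → f i ≡ a + i) → applyUpTo f n ≡ interval a n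
applyUpTo≗interval a zero    _   = refl
applyUpTo≗interval a (suc n) f≗a+ = cong₂ _∷_ (trans (f≗a+ 0) (+-identityʳ a))
  (applyUpTo≗interval (suc a) n λ i → trans (f≗a+ (suc i)) (+-suc a i))

map-suc-upTo : ∀ n → map suc (upTo n) ≡ interval 1 n
map-suc-upTo n = trans (map-upTo suc n) (applyUpTo≗interval 1 n λ _ → refl)

module GapCounting {Q : ℕ → Set} (Q? : Decidable Q) (g : ℕ) where

  NoneBetween : ℕ → ℕ → Set
  NoneBetween lo hi = ∀ {z} → z < hi → lo ≤ z → ¬ Q z

  GapFrom : ℕ → ℕ → Set
  GapFrom b x = Q x × 0 < g × Q (x + g) × x + g < b × NoneBetween (suc x) (x + g)

  gapFrom? : ∀ b x → Dec (GapFrom b x)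
  gapFrom? b x = Q? x ×-dec 0 <? g ×-dec Q? (x + g) ×-dec x + g <? b
    ×-dec allUpTo? (λ z → suc x ≤? z →-dec ¬? (Q? z)) (x + g)

  count : List ℕ → ℕ
  count xs = length (filter (_≟ g) xs)

  count-∷ : ∀ x xs → count (x ∷ xs) ≡ 𝟙 (x ≟ g) + count xs
  count-∷ x xs with x ≟ g
  ... | yes x≡g = cong length (filter-accept (_≟ g) x≡g)
  ... | no  x≢g = cong length (filter-reject (_≟ g) x≢g)

  filter-interval-[] : ∀ a n → filter Q? (interval a n) ≡ [] → NoneBetween a (a + n)
  filter-interval-[] a zero    _ z<a a≤z = ⊥-elim (<⇒≱ (≤-trans z<a (≤-reflexive (+-identityʳ a))) a≤z)
  filter-interval-[] a (suc n) eq with Q? a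
  filter-interval-[] a (suc n) () | yes _
  ... | no ¬Qa = none
    where
    none : NoneBetween a (a + suc n)
    none z<end a≤z with m≤n⇒m<n∨m≡n a≤z
    ... | inj₁ a<z  = filter-interval-[] (suc a) n eq (≤-trans z<end (≤-reflexive (+-suc a n))) a<z
    ... | inj₂ refl = ¬Qa

  filter-interval-∷ : ∀ a n {y ys} → filter Q? (interval a n) ≡ y ∷ ys →
                      a ≤ y × y < a + n × Q y × NoneBetween a y
  filter-interval-∷ a zero ()
  filter-interval-∷ a (suc n) eq with Q? a
  filter-interval-∷ a (suc n) refl | yes Qa =
    ≤-refl , m<m+n a (s≤s z≤n) , Qa , λ z<a a≤z → ⊥-elim (<⇒≱ z<a a≤z)
  ... | no ¬Qa with filter-interval-∷ (suc a) n eq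
  ...   | a<y , y<end , Qy , none = <⇒≤ a<y , ≤-trans y<end (≤-reflexive (sym (+-suc a n))) , Qy , none′
    where
    none′ : NoneBetween a _
    none′ z<y a≤z with m≤n⇒m<n∨m≡n a≤z
    ... | inj₁ a<z  = none z<y a<z
    ... | inj₂ refl = ¬Qa

  gapFrom-last : ∀ {a b} → NoneBetween (suc a) b → ¬ GapFrom b a
  gapFrom-last {a} none (_ , 0<g , Qa+g , a+g<b , _) = none a+g<b (m<m+n a 0<g) Qa+g

  gapFrom-next : ∀ {a b y} → Q a → a < y → y < b → Q y → NoneBetween (suc a) y →
                 𝟙 (y ∸ a ≟ g) ≡ 𝟙 (gapFrom? b a)
  gapFrom-next {a} {b} {y} Qa a<y y<b Qy none = 𝟙-cong (y ∸ a ≟ g) (gapFrom? b a) to from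
    where
    y≡a+[y∸a] : y ≡ a + (y ∸ a)
    y≡a+[y∸a] = sym (m+[n∸m]≡n (<⇒≤ a<y))

    to : y ∸ a ≡ g → GapFrom b a
    to refl = Qa , m<n⇒0<n∸m a<y , subst Q y≡a+[y∸a] Qy , subst (_< b) y≡a+[y∸a] y<b ,
              subst (NoneBetween (suc a)) y≡a+[y∸a] none

    from : GapFrom b a → y ∸ a ≡ g
    from (_ , 0<g , Qa+g , _ , none′) with <-cmp y (a + g)
    ... | tri< y<a+g _ _ = ⊥-elim (none′ y<a+g a<y Qy)
    ... | tri≈ _ refl _  = m+n∸m≡n a g
    ... | tri> _ _ a+g<y = ⊥-elim (none a+g<y (m<m+n a 0<g) Qa+g)

  count-diffs-∷ : ∀ {a n b} ys → Q a → suc a + n ≡ b → filter Q? (interval (suc a) n) ≡ ys →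
                  count (diffs (a ∷ ys)) ≡ 𝟙 (gapFrom? b a) + count (diffs ys)
  count-diffs-∷ {a} {n} {b} [] Qa refl eq =
    sym (trans (+-identityʳ _) (𝟙-no (gapFrom? b a) (gapFrom-last (filter-interval-[] (suc a) n eq))))
  count-diffs-∷ {a} {n} {b} (y ∷ ys) Qa refl eq with filter-interval-∷ (suc a) n eq
  ... | a<y , y<b , Qy , none =
    trans (count-∷ (y ∸ a) (diffs (y ∷ ys))) (cong (_+ _) (gapFrom-next Qa a<y y<b Qy none))

  count-gaps : ∀ a n {b} → a + n ≡ b →
               count (diffs (filter Q? (interval a n))) ≡ sumFrom a n (λ x → 𝟙 (gapFrom? b x))
  count-gaps a zero    _ = refl
  count-gaps a (suc n) {b} a+n≡b = by-cases (Q? a)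
    where
    open ≡-Reasoning
    rest : suc a + n ≡ b
    rest = trans (sym (+-suc a n)) a+n≡b
    S : ℕ
    S = sumFrom (suc a) n (λ x → 𝟙 (gapFrom? b x))

    by-cases : Dec (Q a) → count (diffs (filter Q? (interval a (suc n)))) ≡ 𝟙 (gapFrom? b a) + S
    by-cases (yes Qa) = begin
      count (diffs (filter Q? (a ∷ interval (suc a) n)))
        ≡⟨ cong (count ∘ diffs) (filter-accept Q? Qa) ⟩
      count (diffs (a ∷ filter Q? (interval (suc a) n)))
        ≡⟨ count-diffs-∷ _ Qa rest refl ⟩
      𝟙 (gapFrom? b a) + count (diffs (filter Q? (interval (suc a) n)))
        ≡⟨ cong (𝟙 (gapFrom? b a) +_) (count-gaps (suc a) n rest) ⟩
      𝟙 (gapFrom? b a) + S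
        ∎
    by-cases (no ¬Qa) = begin
      count (diffs (filter Q? (a ∷ interval (suc a) n)))
        ≡⟨ cong (count ∘ diffs) (filter-reject Q? ¬Qa) ⟩
      count (diffs (filter Q? (interval (suc a) n)))
        ≡⟨ count-gaps (suc a) n rest ⟩
      S
        ≡⟨ cong (_+ S) (𝟙-no (gapFrom? b a) (¬Qa ∘ proj₁)) ⟨
      𝟙 (gapFrom? b a) + S
        ∎

coprime-+-∣⁺ : ∀ {m n k} → n ∣ k → Coprime m n → Coprime (k + m) n
coprime-+-∣⁺ n∣k c (d∣k+m , d∣n) = c (∣m+n∣m⇒∣n d∣k+m (∣-trans d∣n n∣k) , d∣n)

coprime-+-∣⁻ : ∀ {m n k} → n ∣ k → Coprime (k + m) n → Coprime m n
coprime-+-∣⁻ n∣k c (d∣m , d∣n) = c (∣m∣n⇒∣m+n (∣-trans d∣n n∣k) d∣m , d∣n)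

coprime-∣ʳ : ∀ {m n o} → n ∣ o → Coprime m o → Coprime m n
coprime-∣ʳ n∣o c (d∣m , d∣n) = c (d∣m , ∣-trans d∣n n∣o)

coprime-prime-*⁺ : ∀ {m n p} → Prime p → ¬ p ∣ m → Coprime m n → Coprime m (p * n)
coprime-prime-*⁺ {m} {n} {p} pp p∤m c {d} (d∣m , d∣pn) = c (d∣m , coprime-divisor d⊥p d∣pn)
  where
  d⊥p : Coprime d p
  d⊥p (e∣d , e∣p) with prime⇒irreducible pp e∣p
  ... | inj₁ e≡1  = e≡1
  ... | inj₂ refl = ⊥-elim (p∤m (∣-trans e∣d d∣m))

module _ {p n m : ℕ} (pp : Prime p) (p∤n : ¬ p ∣ n) where

  private
    ∣-+-*-distinct : ∀ {j j′} → j < j′ → j′ < p → p ∣ j * n + m → p ∣ j′ * n + m → ⊥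
    ∣-+-*-distinct {j} {j′} j<j′ j′<p p∣jn+m p∣j′n+m with euclidsLemma (j′ ∸ j) n pp p∣[j′∸j]n
      where
      split : j′ * n + m ≡ j * n + m + (j′ ∸ j) * n
      split = begin
        j′ * n + m                  ≡⟨ cong (λ i → i * n + m) (m∸n+n≡m (<⇒≤ j<j′)) ⟨
        (j′ ∸ j + j) * n + m        ≡⟨ cong (_+ m) (*-distribʳ-+ n (j′ ∸ j) j) ⟩
        (j′ ∸ j) * n + j * n + m    ≡⟨ +-assoc ((j′ ∸ j) * n) (j * n) m ⟩
        (j′ ∸ j) * n + (j * n + m)  ≡⟨ +-comm ((j′ ∸ j) * n) (j * n + m) ⟩
        j * n + m + (j′ ∸ j) * n    ∎
        where open ≡-Reasoning
      p∣[j′∸j]n : p ∣ (j′ ∸ j) * n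
      p∣[j′∸j]n = ∣m+n∣m⇒∣n (subst (p ∣_) split p∣j′n+m) p∣jn+m
    ... | inj₂ p∣n      = p∤n p∣n
    ... | inj₁ p∣j′∸j  =
      <⇒≱ j′<p (≤-trans (∣⇒≤ {{>-nonZero (m<n⇒0<n∸m j<j′)}} p∣j′∸j) (m∸n≤m j′ j))

  ∣-+-*-unique : ∀ {j j′} → j < p → j′ < p → p ∣ j * n + m → p ∣ j′ * n + m → j ≡ j′
  ∣-+-*-unique {j} {j′} j<p j′<p p∣jn+m p∣j′n+m with <-cmp j j′
  ... | tri< j<j′ _ _ = ⊥-elim (∣-+-*-distinct j<j′ j′<p p∣jn+m p∣j′n+m)
  ... | tri≈ _ j≡j′ _ = j≡j′
  ... | tri> _ _ j′<j = ⊥-elim (∣-+-*-distinct j′<j j<p p∣j′n+m p∣jn+m)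

avoiders-≥ : ∀ {p n} → Prime p → ¬ p ∣ n → ∀ a b →
             p ∸ 2 ≤ sumFrom 0 p (λ j → 𝟙 (¬? (p ∣? j * n + a) ×-dec ¬? (p ∣? j * n + b)))
avoiders-≥ {p} {n} pp p∤n a b = m≤n+o⇒m∸n≤o p 2 (begin
  p
    ≡⟨ trans (sym (*-identityˡ p)) (sym (sumFrom-const 0 p 1)) ⟩
  sumFrom 0 p (λ _ → 1)
    ≤⟨ sumFrom-mono-≤ 0 p (λ j _ _ → 𝟙-cover (p ∣? j * n + a) (p ∣? j * n + b)) ⟩
  sumFrom 0 p (λ j → U j + (A j + B j))
    ≡⟨ trans (sumFrom-distrib-+ 0 p U _) (cong (sumFrom 0 p U +_) (sumFrom-distrib-+ 0 p A B)) ⟩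
  sumFrom 0 p U + (sumFrom 0 p A + sumFrom 0 p B)
    ≤⟨ +-monoʳ-≤ (sumFrom 0 p U) (+-mono-≤ (at-most-one a) (at-most-one b)) ⟩
  sumFrom 0 p U + 2
    ≡⟨ +-comm (sumFrom 0 p U) 2 ⟩
  2 + sumFrom 0 p U
    ∎)
  where
  open ≤-Reasoning
  A B U : ℕ → ℕ
  A j = 𝟙 (p ∣? j * n + a)
  B j = 𝟙 (p ∣? j * n + b)
  U j = 𝟙 (¬? (p ∣? j * n + a) ×-dec ¬? (p ∣? j * n + b))

  at-most-one : ∀ c → sumFrom 0 p (λ j → 𝟙 (p ∣? j * n + c)) ≤ 1
  at-most-one c = sumFrom-𝟙-≤1 (λ j → p ∣? j * n + c) 0 p (λ j j′ → ∣-+-*-unique pp p∤n)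

primorial-stable : ∀ {q} n → q ≤ n → (∀ {c} → q < c → c ≤ n → ¬ Prime c) → primorial n ≡ primorial q
primorial-stable n q≤n none with m≤n⇒m<n∨m≡n q≤n
... | inj₂ refl = refl
primorial-stable zero    _ none | inj₁ ()
primorial-stable (suc n) _ none | inj₁ q<1+n with prime? (suc n)
... | yes p1+n = ⊥-elim (none q<1+n ≤-refl p1+n)
... | no  _    = primorial-stable n (≤-pred q<1+n) λ q<c c≤n → none q<c (m≤n⇒m≤1+n c≤n)

primorial-next : ∀ {q p} → NextPrime q p → primorial p ≡ p * primorial q
primorial-next {p = zero} (_ , _ , () , _)
primorial-next {q} {suc n} (_ , pp , q<p , none) with prime? (suc n)
... | yes _  = cong (suc n *_) (primorial-stable n (≤-pred q<p) λ q<c c≤n → none _ q<c (s≤s c≤n))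
... | no ¬pp = ⊥-elim (¬pp pp)

prime∤primorial : ∀ {p} n → Prime p → n < p → ¬ p ∣ primorial n
prime∤primorial zero    pp _   p∣1 = ¬prime[1] (subst Prime (∣1⇒≡1 p∣1) pp)
prime∤primorial (suc n) pp n<p p∣# with prime? (suc n)
... | no _ = prime∤primorial n pp (<-trans (n<1+n n) n<p) p∣#
... | yes _ with euclidsLemma (suc n) (primorial n) pp p∣#
...   | inj₁ p∣1+n = <⇒≱ n<p (∣⇒≤ p∣1+n)
...   | inj₂ p∣#n  = prime∤primorial n pp (<-trans (n<1+n n) n<p) p∣#n

module CoprimeGaps (g : ℕ) where

  module Gaps (P : ℕ) = GapCounting (λ r → coprime? r P) g
  open Gaps using (GapFrom; gapFrom?)

  -- The period of 𝒢(P) ends at P + 1, so its gaps are those ending below 2 + P.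
  gapStart : ℕ → ℕ → ℕ
  gapStart P x = 𝟙 (gapFrom? P (2 + P) x)

  nGap≡sumFrom : ∀ P → nGap g P ≡ sumFrom 1 P (gapStart P)
  nGap≡sumFrom P = begin
    nGap g P
      ≡⟨ cong (Gaps.count P ∘ diffs ∘ filter (λ r → coprime? r P)) (map-suc-upTo (suc P)) ⟩
    Gaps.count P (diffs (filter (λ r → coprime? r P) (interval 1 (suc P))))
      ≡⟨ Gaps.count-gaps P 1 (suc P) refl ⟩
    sumFrom 1 (suc P) (gapStart P)
      ≡⟨ cong (λ n → sumFrom 1 n (gapStart P)) (+-comm 1 P) ⟩
    sumFrom 1 (P + 1) (gapStart P)
      ≡⟨ sumFrom-+ 1 P 1 (gapStart P) ⟩
    sumFrom 1 P (gapStart P) + (gapStart P (P + 1) + 0)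
      ≡⟨ cong (λ t → sumFrom 1 P (gapStart P) + (t + 0)) no-gap-from-P+1 ⟩
    sumFrom 1 P (gapStart P) + 0
      ≡⟨ +-identityʳ _ ⟩
    sumFrom 1 P (gapStart P) ∎
    where
    open ≡-Reasoning
    no-gap-from-P+1 : gapStart P (P + 1) ≡ 0
    no-gap-from-P+1 = 𝟙-no (gapFrom? P (2 + P) (P + 1)) λ (_ , 0<g , _ , P+1+g<2+P , _) →
      <⇒≱ P+1+g<2+P (≤-trans (m<m+n (suc P) 0<g) (≤-reflexive (cong (_+ g) (+-comm 1 P))))

  gapFrom-lift : ∀ {p P x j} → Prime p → j < p → GapFrom P (2 + P) x →
                 ¬ p ∣ j * P + x → ¬ p ∣ j * P + (x + g) → GapFrom (p * P) (2 + p * P) (j * P + x)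
  gapFrom-lift {p} {P} {x} {j} pp j<p (x⊥P , 0<g , x+g⊥P , x+g<2+P , none) p∤jP+x p∤jP+x+g =
    coprime-prime-*⁺ pp p∤jP+x (coprime-+-∣⁺ P∣jP x⊥P) ,
    0<g ,
    subst (λ y → Coprime y (p * P)) (sym (+-assoc (j * P) x g))
      (coprime-prime-*⁺ pp p∤jP+x+g (coprime-+-∣⁺ P∣jP x+g⊥P)) ,
    below ,
    none′
    where
    P∣jP : P ∣ j * P
    P∣jP = n∣m*n j

    below : j * P + x + g < 2 + p * P
    below = begin-strict
      j * P + x + g    ≡⟨ +-assoc (j * P) x g ⟩
      j * P + (x + g)  <⟨ +-monoʳ-< (j * P) x+g<2+P ⟩
      j * P + (2 + P)  ≡⟨ +-comm (j * P) (2 + P) ⟩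
      2 + suc j * P    ≤⟨ +-monoʳ-≤ 2 (*-monoˡ-≤ P j<p) ⟩
      2 + p * P        ∎
      where open ≤-Reasoning

    none′ : Gaps.NoneBetween (p * P) (suc (j * P + x)) (j * P + x + g)
    none′ {z} z<end jP+x<z z⊥pP = none w<x+g x<w w⊥P
      where
      w : ℕ
      w = z ∸ j * P
      z≡jP+w : z ≡ j * P + w
      z≡jP+w = sym (m+[n∸m]≡n (≤-trans (m≤m+n (j * P) x) (<⇒≤ jP+x<z)))
      w⊥P : Coprime w P
      w⊥P = coprime-+-∣⁻ P∣jP (subst (λ y → Coprime y P) z≡jP+w (coprime-∣ʳ (n∣m*n p) z⊥pP))
      w<x+g : w < x + g
      w<x+g = +-cancelˡ-< (j * P) w (x + g)
        (subst₂ _<_ z≡jP+w (+-assoc (j * P) x g) z<end)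
      x<w : x < w
      x<w = +-cancelˡ-< (j * P) x w (subst (j * P + x <_) z≡jP+w jP+x<z)

  nGap-lower-bound : ∀ {p P} → Prime p → ¬ p ∣ P → (p ∸ 2) * nGap g P ≤ nGap g (p * P)
  nGap-lower-bound {p} {P} pp p∤P = begin
    (p ∸ 2) * nGap g P
      ≡⟨ cong ((p ∸ 2) *_) (nGap≡sumFrom P) ⟩
    (p ∸ 2) * sumFrom 1 P T
      ≡⟨ *-distribˡ-sumFrom (p ∸ 2) 1 P T ⟩
    sumFrom 1 P (λ x → (p ∸ 2) * T x)
      ≤⟨ sumFrom-mono-≤ 1 P (λ x _ _ → enough-avoiders x) ⟩
    sumFrom 1 P (λ x → T x * sumFrom 0 p (avoid x))
      ≡⟨ sumFrom-cong 1 P (λ x → *-distribˡ-sumFrom (T x) 0 p (avoid x)) ⟩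
    sumFrom 1 P (λ x → sumFrom 0 p (λ j → T x * avoid x j))
      ≡⟨ sumFrom-comm 1 P 0 p (λ x j → T x * avoid x j) ⟩
    sumFrom 0 p (λ j → sumFrom 1 P (λ x → T x * avoid x j))
      ≤⟨ sumFrom-mono-≤ 0 p (λ j _ j<p → sumFrom-mono-≤ 1 P (λ x _ _ → lift x j j<p)) ⟩
    sumFrom 0 p (λ j → sumFrom 1 P (λ x → T′ (j * P + x)))
      ≡⟨ sumFrom-blocks 1 p P T′ ⟨
    sumFrom 1 (p * P) T′
      ≡⟨ nGap≡sumFrom (p * P) ⟨
    nGap g (p * P) ∎
    where
    open ≤-Reasoning
    T T′ : ℕ → ℕ
    T  = gapStart P
    T′ = gapStart (p * P)

    avoid : ℕ → ℕ → ℕ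
    avoid x j = 𝟙 (¬? (p ∣? j * P + x) ×-dec ¬? (p ∣? j * P + (x + g)))

    enough-avoiders : ∀ x → (p ∸ 2) * T x ≤ T x * sumFrom 0 p (avoid x)
    enough-avoiders x = ≤-trans (≤-reflexive (*-comm (p ∸ 2) (T x)))
                                (*-monoʳ-≤ (T x) (avoiders-≥ pp p∤P x (x + g)))

    lift : ∀ x j → j < p → T x * avoid x j ≤ T′ (j * P + x)
    lift x j j<p with gapFrom? P (2 + P) x | p ∣? j * P + x | p ∣? j * P + (x + g)
    ... | no _    | _        | _         = z≤n
    ... | yes _   | yes _    | _         = z≤n
    ... | yes _   | no _     | yes _     = z≤n
    ... | yes gap | no p∤x′  | no p∤x′+g = ≤-reflexive (sym
      (𝟙-yes (gapFrom? (p * P) (2 + p * P) (j * P + x)) (gapFrom-lift pp j<p gap p∤x′ p∤x′+g)))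

  nGap-pos-of-∈ : ∀ {P} → g ∈ cycleOfGaps P → 0 < nGap g P
  nGap-pos-of-∈ {P} g∈ with filter (_≟ g) (cycleOfGaps P) | ∈-filter⁺ (_≟ g) g∈ refl
  ... | _ ∷ _ | _ = s≤s z≤n
  ... | []    | ()

  nGap-primorial-suc-pos : ∀ {n} → 2 ≤ n → 0 < nGap g (primorial n) → 0 < nGap g (primorial (suc n))
  nGap-primorial-suc-pos {n} 2≤n pos with prime? (suc n)
  ... | no  _    = pos
  ... | yes p1+n = <-≤-trans (*-mono-< (m<n⇒0<n∸m (s≤s 2≤n)) pos)
                             (nGap-lower-bound p1+n (prime∤primorial n p1+n ≤-refl))

  nGap-primorial-pos : ∀ {m} n → 2 ≤ m → m ≤ n → 0 < nGap g (primorial m) → 0 < nGap g (primorial n)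
  nGap-primorial-pos n 2≤m m≤n pos with m≤n⇒m<n∨m≡n m≤n
  ... | inj₂ refl = pos
  nGap-primorial-pos zero    _   _ _   | inj₁ ()
  nGap-primorial-pos (suc n) 2≤m _ pos | inj₁ m<1+n =
    nGap-primorial-suc-pos (≤-trans 2≤m (≤-pred m<1+n)) (nGap-primorial-pos n 2≤m (≤-pred m<1+n) pos)

parity : ∀ n → 2 ∣ n ⊎ 2 ∣ suc n
parity zero          = inj₁ (2 ∣0)
parity (suc zero)    = inj₂ ∣-refl
parity (suc (suc n)) = Sum.map (∣m∣n⇒∣m+n ∣-refl) (∣m∣n⇒∣m+n ∣-refl) (parity n)

residue-mod-3 : ∀ n → 3 ∣ n ⊎ 3 ∣ suc n ⊎ 3 ∣ suc (suc n)
residue-mod-3 zero                = inj₁ (3 ∣0)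
residue-mod-3 (suc zero)          = inj₂ (inj₂ ∣-refl)
residue-mod-3 (suc (suc zero))    = inj₂ (inj₁ ∣-refl)
residue-mod-3 (suc (suc (suc n))) =
  Sum.map (∣m∣n⇒∣m+n ∣-refl) (Sum.map (∣m∣n⇒∣m+n ∣-refl) (∣m∣n⇒∣m+n ∣-refl)) (residue-mod-3 n)

module _ {q : ℕ} (4≤q : 4 ≤ q) (pq : Prime q) where

  private
    2<4 : 2 < 4
    2<4 = s≤s (s≤s (s≤s z≤n))

    ¬prime-by : ∀ d k .{{_ : NonTrivial d}} → d < 4 → d ∣ k + q → ¬ Prime (q + k)
    ¬prime-by d k d<4 d∣k+q = composite⇒¬prime
      (composite (<-≤-trans d<4 (≤-trans 4≤q (m≤m+n q k))) (subst (d ∣_) (+-comm k q) d∣k+q))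

    2∣1+q : 2 ∣ suc q
    2∣1+q with parity q
    ... | inj₁ 2∣q   = ⊥-elim (¬prime-by 2 0 2<4 2∣q (subst Prime (sym (+-identityʳ q)) pq))
    ... | inj₂ 2∣1+q = 2∣1+q

    even-offset : ∀ k → 0 < k → k < 6 → Prime (q + k) → k ≡ 2 ⊎ k ≡ 4
    even-offset 1 _ _ p = ⊥-elim (¬prime-by 2 1 2<4 2∣1+q p)
    even-offset 2 _ _ _ = inj₁ refl
    even-offset 3 _ _ p = ⊥-elim (¬prime-by 2 3 2<4 (∣m∣n⇒∣m+n ∣-refl 2∣1+q) p)
    even-offset 4 _ _ _ = inj₂ refl
    even-offset 5 _ _ p = ⊥-elim (¬prime-by 2 5 2<4 (∣m∣n⇒∣m+n ∣-refl (∣m∣n⇒∣m+n ∣-refl 2∣1+q)) p)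
    even-offset (suc (suc (suc (suc (suc (suc _)))))) _ (s≤s (s≤s (s≤s (s≤s (s≤s (s≤s ())))))) _

    no-prime-triplet : Prime (q + 2) → Prime (q + 4) → ⊥
    no-prime-triplet p2 p4 with residue-mod-3 q
    ... | inj₁ 3∣q          = ¬prime-by 3 0 ≤-refl 3∣q (subst Prime (sym (+-identityʳ q)) pq)
    ... | inj₂ (inj₁ 3∣1+q) = ¬prime-by 3 4 ≤-refl (∣m∣n⇒∣m+n ∣-refl 3∣1+q) p4
    ... | inj₂ (inj₂ 3∣2+q) = ¬prime-by 3 2 ≤-refl 3∣2+q p2

  -- Parity leaves only q + 2 and q + 4, and one of q, q + 2, q + 4 is a multiple of 3.
  no-three-primes-within-6 : ∀ {a c} → Prime (q + a) → Prime (q + c) → 0 < a → a < c → c < 6 → ⊥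
  no-three-primes-within-6 {a} {c} pa pc 0<a a<c c<6
    with even-offset a 0<a (<-trans a<c c<6) pa | even-offset c (<-trans 0<a a<c) c<6 pc
  ... | inj₁ refl | inj₁ refl = <-irrefl refl a<c
  ... | inj₁ refl | inj₂ refl = no-prime-triplet pa pc
  ... | inj₂ refl | inj₁ refl = <⇒≱ a<c (s≤s (s≤s z≤n))
  ... | inj₂ refl | inj₂ refl = <-irrefl refl a<c

prime-gap-6 : ∀ {q p r} → 4 ≤ q → Prime q → Prime p → Prime r → q < p → p < r → q + 6 ≤ r
prime-gap-6 {q} {p} {r} 4≤q pq pp pr q<p p<r = ≮⇒≥ λ r<q+6 →
  no-three-primes-within-6 4≤q pq (subst Prime p≡q+[p∸q] pp) (subst Prime r≡q+[r∸q] pr)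
    (m<n⇒0<n∸m q<p) (∸-monoˡ-< p<r (<⇒≤ q<p)) (+-cancelˡ-< q (r ∸ q) 6 (subst (_< q + 6) r≡q+[r∸q] r<q+6))
  where
  p≡q+[p∸q] : p ≡ q + (p ∸ q)
  p≡q+[p∸q] = sym (m+[n∸m]≡n (<⇒≤ q<p))
  r≡q+[r∸q] : r ≡ q + (r ∸ q)
  r≡q+[r∸q] = sym (m+[n∸m]≡n (<⇒≤ (<-trans q<p p<r)))

density-ratio : ∀ {p q r} → 6 ≤ p → q < p → q + 6 ≤ r → (p + q) * p < (p ∸ 2) * (r + p)
density-ratio {suc (suc s)} {q} {r} (s≤s (s≤s 4≤s)) (s≤s q≤1+s) q+6≤r = begin-strict
  (2 + s + q) * (2 + s)          ≡⟨ expand s q ⟩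
  s * (s + q + 4) + (2 * q + 4)  <⟨ +-monoʳ-< (s * (s + q + 4)) 2q+4<4s ⟩
  s * (s + q + 4) + 4 * s        ≡⟨ collect s q ⟩
  s * (q + 6 + (2 + s))          ≤⟨ *-monoʳ-≤ s (+-monoˡ-≤ (2 + s) q+6≤r) ⟩
  s * (r + (2 + s))              ∎
  where
  open ≤-Reasoning
  expand : ∀ s q → (2 + s + q) * (2 + s) ≡ s * (s + q + 4) + (2 * q + 4)
  expand = solve-∀
  collect : ∀ s q → s * (s + q + 4) + 4 * s ≡ s * (q + 6 + (2 + s))
  collect = solve-∀
  double : ∀ s → 2 * (1 + s) + 4 ≡ 2 * s + 6
  double = solve-∀
  quadruple : ∀ s → 2 * s + 2 * s ≡ 4 * s
  quadruple = solve-∀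
  2q+4<4s : 2 * q + 4 < 4 * s
  2q+4<4s = begin-strict
    2 * q + 4        ≤⟨ +-monoˡ-≤ 4 (*-monoʳ-≤ 2 q≤1+s) ⟩
    2 * (1 + s) + 4  ≡⟨ double s ⟩
    2 * s + 6        <⟨ +-monoʳ-< (2 * s) (≤-trans (n≤1+n 7) (*-monoʳ-≤ 2 4≤s)) ⟩
    2 * s + 2 * s    ≡⟨ quadruple s ⟩
    4 * s            ∎

cross-<⇒/-< : ∀ a b c d .{{_ : NonZero c}} .{{_ : NonZero d}} →
              a * d < b * c → ℤ.+ a ℚᵘ./ c ℚᵘ.< ℤ.+ b ℚᵘ./ d
cross-<⇒/-< a b (suc c) (suc d) ad<bc = *<* (subst₂ ℤ._<_ (pos-* a (suc d)) (pos-* b (suc c)) (+<+ ad<bc))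

scaled-ratio-< : ∀ {p q r k N N′ P} → 0 < N → 0 < P → k * N ≤ N′ → (p + q) * p < k * (r + p) →
                 N * (p + q) * (p * P) < N′ * (r + p) * P
scaled-ratio-< {p} {q} {r} {k} {N} {N′} {P} 0<N 0<P kN≤N′ ratio = begin-strict
  N * (p + q) * (p * P)    ≡⟨ regroupˡ N p q P ⟩
  N * ((p + q) * p) * P    <⟨ *-monoˡ-< P {{>-nonZero 0<P}} (*-monoʳ-< N {{>-nonZero 0<N}} ratio) ⟩
  N * (k * (r + p)) * P    ≡⟨ regroupʳ N k (r + p) P ⟩
  k * N * (r + p) * P      ≤⟨ *-monoˡ-≤ P (*-monoˡ-≤ (r + p) kN≤N′) ⟩
  N′ * (r + p) * P         ∎
  where
  open ≤-Reasoning
  regroupˡ : ∀ N p q P → N * (p + q) * (p * P) ≡ N * ((p + q) * p) * P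
  regroupˡ = solve-∀
  regroupʳ : ∀ N k x P → N * (k * x) * P ≡ k * N * x * P
  regroupʳ = solve-∀

theorem3p3 : (p₀ p₁ g : ℕ) → Prime p₀ → 3 ≤ p₀ → NextPrime p₀ p₁ →
    g ∈ cycleOfGaps (primorial p₀) →
    (q p r : ℕ) → NextPrime q p → NextPrime p r → p₁ < p →
    η g p r > η g q p
theorem3p3 p₀ p₁ g _ 3≤p₀ (_ , pp₁ , p₀<p₁ , _) g∈𝒢 q p r q→p@(pq , pp , q<p , between) (_ , pr , p<r , _) p₁<p =
  cross-<⇒/-< _ _ (primorial q) (primorial p) {{primorial-nonZero q}} {{primorial-nonZero p}}
    (subst (λ P → Nq * (p + q) * P < nGap g (primorial p) * (r + p) * primorial q) (sym (primorial-next q→p))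
      (scaled-ratio-< {p} {q} {r} {p ∸ 2} Nq>0 (>-nonZero⁻¹ (primorial q) {{primorial-nonZero q}}) lower
        (density-ratio 6≤p q<p (prime-gap-6 4≤q pq pp pr q<p p<r))))
  where
  open CoprimeGaps g
  Nq : ℕ
  Nq = nGap g (primorial q)
  p₁≤q : p₁ ≤ q
  p₁≤q = ≮⇒≥ λ q<p₁ → between p₁ q<p₁ p₁<p pp₁
  4≤q : 4 ≤ q
  4≤q = ≤-trans (s≤s 3≤p₀) (≤-trans p₀<p₁ p₁≤q)
  6≤p : 6 ≤ p
  6≤p = ≤-trans (s≤s (≤∧≢⇒< 4≤q λ 4≡q → composite⇒¬prime composite[4] (subst Prime (sym 4≡q) pq))) q<p
  Nq>0 : 0 < Nq
  Nq>0 = nGap-primorial-pos q (≤-trans (n≤1+n 2) 3≤p₀) (≤-trans (<⇒≤ p₀<p₁) p₁≤q)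
                              (nGap-pos-of-∈ {primorial p₀} g∈𝒢)
  lower : (p ∸ 2) * Nq ≤ nGap g (primorial p)
  lower = subst (λ P → (p ∸ 2) * Nq ≤ nGap g P) (sym (primorial-next q→p))
                (nGap-lower-bound pp (prime∤primorial q pp q<p))
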